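{- Let $H$ be a split graph that is not a complete split graph, let $G=\overline{H}$ (a split graph), and fix a partition of $V(G)$ into a clique $C(G)$ and an independent set $I(G)$. Let $G_1,G_2$ be two vertex-disjoint copies of $G$, with the induced partitions $V(G_j)=C(G_j)\cup I(G_j)$, $j=1,2$. Let $G'$ be the graph with $V(G')=V(G_1)\cup V(G_2)$ and $E(G')=E(G_1)\cup E(G_2)\cup\{uv: u\in C(G_1),v\in C(G_2)\}\cup\{uv:u\in C(G_1),v\in I(G_2)\}\cup\{uv:u\in C(G_2),v\in I(G_1)\}$. Then $\mathrm{box}(G')\le t(H)$.
   Context: All graphs are finite, simple and undirected; $\overline{H}$ is the complement of $H$. A split graph is a graph whose vertex set can be partitioned into a clique and an independent set. A complete split graph is a split graph having such a partition into a clique $C$ and independent set $I$ with every vertex of $C$ adjacent to every vertex of $I$. A threshold graph is a graph admitting a real $S$ and vertex weights $w$ with distinct $u,v$ adjacent iff $w(u)+w(v)\ge S$; the threshold dimension $t(H)$ is the least $k$ such that $E(H)$ is the union of the edge sets of $k$ threshold graphs on $V(H)$. The boxicity $\mathrm{box}(G)$ is the minimum $k$ such that $G$ is the intersection graph of $k$-dimensional axis-parallel boxes, equivalently the intersection of $k$ interval graphs on $V(G)$.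
   Formalization: The threshold graphs defining t(H) have only rational weights and thresholds instead of real ones, and the boxes representing G′ are taken with rational interval endpoints. -}

module Defs where

open import Level using (0ℓ)
open import Data.Nat using (ℕ; _≤_)
open import Data.Fin using (Fin)
open import Data.Bool using (Bool; true; false)
open import Data.Sum using (_⊎_; inj₁; inj₂)
open import Data.Product using (Σ; _×_; ∃; ∃-syntax)
open import Data.Rational as ℚ using (ℚ)
open import Relation.Nullary using (¬_)
open import Relation.Binary.PropositionalEquality using (_≡_; _≢_)
open import Function.Bundles using (_⇔_)

Graph : Set → Set₁
Graph V = V → V → Set

IsSimple : {V : Set} → Graph V → Set
IsSimple {V} E = (∀ u v → E u v → E v u) × (∀ u → ¬ E u u)

compl : {V : Set} → Graph V → Graph V
compl E u v = (u ≢ v) × (¬ E u v)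

IsSplitPartition : {V : Set} → Graph V → (V → Bool) → Set
IsSplitPartition {V} E c =
  (∀ u v → c u ≡ true → c v ≡ true → u ≢ v → E u v) ×
  (∀ u v → c u ≡ false → c v ≡ false → ¬ E u v)

IsSplit : {V : Set} → Graph V → Set
IsSplit {V} E = Σ (V → Bool) λ c → IsSplitPartition E c

IsCompleteSplit : {V : Set} → Graph V → Set
IsCompleteSplit {V} E = Σ (V → Bool) λ c → IsSplitPartition E c ×
  (∀ u v → c u ≡ true → c v ≡ false → E u v)

-- The graph G' built from two disjoint copies (inj₁ / inj₂) of G with
-- partition c (C = true, I = false).
doubled : {V : Set} → Graph V → (V → Bool) → Graph (V ⊎ V)
doubled E c (inj₁ u) (inj₁ v) = E u v
doubled E c (inj₂ u) (inj₂ v) = E u v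
doubled E c (inj₁ u) (inj₂ v) =
  ((c u ≡ true) × (c v ≡ true)) ⊎ ((c u ≡ true) × (c v ≡ false)) ⊎ ((c v ≡ true) × (c u ≡ false))
doubled E c (inj₂ u) (inj₁ v) =
  ((c v ≡ true) × (c u ≡ true)) ⊎ ((c v ≡ true) × (c u ≡ false)) ⊎ ((c u ≡ true) × (c v ≡ false))

-- E(H) is the union of the edge sets of k threshold graphs on V
-- (threshold graph i: weights w i, threshold S i; distinct u,v adjacent
-- iff w i u + w i v ≥ S i).  Weights rational.
ThresholdCover : {V : Set} → Graph V → ℕ → Set
ThresholdCover {V} E k =
  Σ (Fin k → V → ℚ) λ w → Σ (Fin k → ℚ) λ S →
    ∀ u v → u ≢ v → (E u v ⇔ (∃[ i ] (S i ℚ.≤ w i u ℚ.+ w i v)))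

-- G is the intersection of k interval graphs on V: vertex x gets, in
-- coordinate i, the closed interval [l i x , r i x].
BoxRep : {V : Set} → Graph V → ℕ → Set
BoxRep {V} E k =
  Σ (Fin k → V → ℚ) λ l → Σ (Fin k → V → ℚ) λ r →
    (∀ i x → l i x ℚ.≤ r i x) ×
    (∀ u v → u ≢ v → (E u v ⇔ (∀ i → (l i u ℚ.≤ r i v) × (l i v ℚ.≤ r i u))))

BoxicityAtMost : {V : Set} → Graph V → ℕ → Set
BoxicityAtMost E k = ∃[ k' ] (k' ≤ k × BoxRep E k')

-- Each threshold graph (wᵢ, Sᵢ) of a cover of H yields one interval graph. In the second
-- copy of G, a clique vertex x gets a long interval [L, ray x] and an independent vertex y
-- the single point "point y", arranged so that point y ≤ ray x iff xy is not an edge of the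
-- i-th threshold graph. Over all i this gives exactly the C–I edges of G = H̄; C stays a
-- clique because all its intervals contain L, and distinct points keep I independent. The
-- first copy is the mirror image t ↦ K − t of the second, with K chosen so that a mirrored
-- interval meets an unmirrored one iff their left ends sum to at most K, i.e. iff one of the
-- two vertices lies in the clique. If t(H) = 0, then H is edgeless, hence complete split.
module Submission where

open import Data.Bool using (Bool; true; false; if_then_else_)
open import Data.Empty using (⊥-elim)
open import Data.Fin using (Fin; zero; suc; toℕ; _≟_)
open import Data.Fin.Properties using (toℕ-injective; toℕ≤n)
open import Data.Nat as ℕ using (ℕ; s≤s)
import Data.Nat.Properties as ℕₚ
open import Data.Product using (Σ; _×_; _,_; proj₁; proj₂; swap; ∃-syntax)
open import Data.Rational as ℚ using (ℚ; 0ℚ; 1ℚ; _+_; _*_; _-_; -_; _≤_; _<_; _⊓_; _⊔_)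
import Data.Rational.Properties as ℚₚ
open import Data.Rational.Solver using (module +-*-Solver)
open import Data.Sum using (_⊎_; inj₁; inj₂; [_,_]′)
open import Function.Base using (_∘_; id)
open import Function.Bundles using (_⇔_; mk⇔; Equivalence)
open import Function.Construct.Composition using (_⇔-∘_)
open import Function.Construct.Symmetry using (⇔-sym)
open import Function.Definitions using (Injective)
open import Relation.Binary.Definitions using (tri<; tri≈; tri>)
open import Relation.Binary.PropositionalEquality using (_≡_; _≢_; refl; sym; cong; subst; subst₂)
open import Relation.Nullary using (¬_; yes; no)
open import Defs

open +-*-Solver
open Equivalence using (to; from)

0<1 : 0ℚ < 1ℚ
0<1 = ℚₚ.positive⁻¹ 1ℚ

*-nonNeg : ∀ {p q} → 0ℚ ≤ p → 0ℚ ≤ q → 0ℚ ≤ p * q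
*-nonNeg {p} {q} 0≤p 0≤q =
  ℚₚ.nonNegative⁻¹ _ {{ℚₚ.nonNeg*nonNeg⇒nonNeg p {{ℚ.nonNegative 0≤p}} q {{ℚ.nonNegative 0≤q}}}}

*-pos : ∀ {p q} → 0ℚ < p → 0ℚ < q → 0ℚ < p * q
*-pos {p} {q} 0<p 0<q = ℚₚ.positive⁻¹ _ {{ℚₚ.pos*pos⇒pos p {{ℚ.positive 0<p}} q {{ℚ.positive 0<q}}}}

q-p+p≡q : ∀ p q → q - p + p ≡ q
q-p+p≡q = solve 2 (λ p q → q :- p :+ p := q) refl

p≤q⇒0≤q-p : ∀ {p q} → p ≤ q → 0ℚ ≤ q - p
p≤q⇒0≤q-p {p} {q} p≤q = subst (_≤ q - p) (ℚₚ.+-inverseʳ p) (ℚₚ.+-monoˡ-≤ (- p) p≤q)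

p<q⇒0<q-p : ∀ {p q} → p < q → 0ℚ < q - p
p<q⇒0<q-p {p} {q} p<q = subst (_< q - p) (ℚₚ.+-inverseʳ p) (ℚₚ.+-monoˡ-< (- p) p<q)

0≤q-p⇒p≤q : ∀ {p q} → 0ℚ ≤ q - p → p ≤ q
0≤q-p⇒p≤q {p} {q} h = subst₂ _≤_ (ℚₚ.+-identityˡ p) (q-p+p≡q p q) (ℚₚ.+-monoˡ-≤ p h)

0<q-p⇒p<q : ∀ {p q} → 0ℚ < q - p → p < q
0<q-p⇒p<q {p} {q} h = subst₂ _<_ (ℚₚ.+-identityˡ p) (q-p+p≡q p q) (ℚₚ.+-monoˡ-< p h)

q+[p-q]≡p : ∀ p q → q + (p - q) ≡ p
q+[p-q]≡p = solve 2 (λ p q → q :+ (p :- q) := p) refl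

[q+r]-q≡r : ∀ q r → q + r - q ≡ r
[q+r]-q≡r = solve 2 (λ q r → q :+ r :- q := r) refl

p-q≤r⇔p≤q+r : ∀ {p q r} → p - q ≤ r ⇔ p ≤ q + r
p-q≤r⇔p≤q+r {p} {q} {r} = mk⇔
  (λ h → subst (_≤ q + r) (q+[p-q]≡p p q) (ℚₚ.+-monoʳ-≤ q h))
  (λ h → subst (p - q ≤_) ([q+r]-q≡r q r) (ℚₚ.+-monoˡ-≤ (- q) h))

r≤p-q⇔q+r≤p : ∀ {p q r} → r ≤ p - q ⇔ q + r ≤ p
r≤p-q⇔q+r≤p {p} {q} {r} = mk⇔
  (λ h → subst (q + r ≤_) (q+[p-q]≡p p q) (ℚₚ.+-monoʳ-≤ q h))
  (λ h → subst (_≤ p - q) ([q+r]-q≡r q r) (ℚₚ.+-monoˡ-≤ (- q) h))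

reflect-≤ : ∀ K {a b} → K - b ≤ K - a ⇔ a ≤ b
reflect-≤ K = mk⇔ (λ h → subst₂ _≤_ (involutive _) (involutive _) (antitone h)) antitone
  where
  antitone : ∀ {a b} → a ≤ b → K - b ≤ K - a
  antitone a≤b = ℚₚ.+-monoʳ-≤ K (ℚₚ.neg-antimono-≤ a≤b)
  involutive : ∀ a → K - (K - a) ≡ a
  involutive = solve 2 (λ K a → K :- (K :- a) := a) refl K

Π-⇔ : ∀ {A : Set} {P Q : A → Set} → (∀ i → P i ⇔ Q i) → (∀ i → P i) ⇔ (∀ i → Q i)
Π-⇔ P⇔Q = mk⇔ (λ p i → to (P⇔Q i) (p i)) (λ q i → from (P⇔Q i) (q i))

Overlap : ℚ → ℚ → ℚ → ℚ → Set
Overlap a b a′ b′ = a ≤ b′ × a′ ≤ b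

overlap-swap : ∀ {a b a′ b′} → Overlap a b a′ b′ ⇔ Overlap a′ b′ a b
overlap-swap = mk⇔ swap swap

overlap-reflect : ∀ K {a b a′ b′} → Overlap (K - b) (K - a) (K - b′) (K - a′) ⇔ Overlap a b a′ b′
overlap-reflect K = mk⇔
  (λ (h , h′) → to (reflect-≤ K) h′ , to (reflect-≤ K) h)
  (λ (h , h′) → from (reflect-≤ K) h′ , from (reflect-≤ K) h)

reflected-overlap⇔ : ∀ K {a b a′ b′} → Overlap (K - b) (K - a) a′ b′ ⇔ (K ≤ b + b′ × a + a′ ≤ K)
reflected-overlap⇔ K = mk⇔
  (λ (h , h′) → to p-q≤r⇔p≤q+r h , to r≤p-q⇔q+r≤p h′)
  (λ (h , h′) → from p-q≤r⇔p≤q+r h , from r≤p-q⇔q+r≤p h′)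

Eventually : (ℚ → Set) → Set
Eventually P = Σ ℚ λ δ → 0ℚ < δ × (∀ {ε} → ε ≤ δ → P ε)

eventually-map : ∀ {P Q : ℚ → Set} → (∀ {ε} → P ε → Q ε) → Eventually P → Eventually Q
eventually-map P⇒Q (δ , 0<δ , P-below) = δ , 0<δ , P⇒Q ∘ P-below

eventually-× : ∀ {P Q : ℚ → Set} → Eventually P → Eventually Q → Eventually (λ ε → P ε × Q ε)
eventually-× (δ , 0<δ , P-below) (δ′ , 0<δ′ , Q-below) =
  δ ⊓ δ′ ,
  [ (λ ⊓≡δ → subst (0ℚ <_) (sym ⊓≡δ) 0<δ) , (λ ⊓≡δ′ → subst (0ℚ <_) (sym ⊓≡δ′) 0<δ′) ]′ (ℚₚ.⊓-sel δ δ′) ,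
  λ ε≤ → P-below (ℚₚ.≤-trans ε≤ (ℚₚ.p⊓q≤p δ δ′)) , Q-below (ℚₚ.≤-trans ε≤ (ℚₚ.p⊓q≤q δ δ′))

eventually-∀ : ∀ {n} {P : Fin n → ℚ → Set} → (∀ i → Eventually (P i)) → Eventually (λ ε → ∀ i → P i ε)
eventually-∀ {ℕ.zero} _ = 1ℚ , 0<1 , λ _ ()
eventually-∀ {ℕ.suc n} P-eventually =
  eventually-map (λ (p₀ , ps) → λ { zero → p₀ ; (suc i) → ps i })
    (eventually-× (P-eventually zero) (eventually-∀ (P-eventually ∘ suc)))

Separated : ℚ → ℚ → ℚ → Set
Separated a b ε = b ≤ a ⊎ ε ≤ b - a

eventually-separated : ∀ a b → Eventually (Separated a b)
eventually-separated a b with b ℚₚ.≤? a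
... | yes b≤a = 1ℚ , 0<1 , λ _ → inj₁ b≤a
... | no b≰a = b - a , p<q⇒0<q-p (ℚₚ.≰⇒> b≰a) , inj₂

boundedBelow : ∀ {n} (f : Fin n → ℚ) → Σ ℚ λ B → ∀ x → B ≤ f x
boundedBelow {ℕ.zero} f = 0ℚ , λ ()
boundedBelow {ℕ.suc n} f with boundedBelow (f ∘ suc)
... | B , B≤f = f zero ⊓ B , λ
  { zero → ℚₚ.p⊓q≤p (f zero) B
  ; (suc x) → ℚₚ.≤-trans (ℚₚ.p⊓q≤q (f zero) B) (B≤f x)
  }

boundedAbove : ∀ {n} (f : Fin n → ℚ) → Σ ℚ λ U → ∀ x → f x ≤ U
boundedAbove {ℕ.zero} f = 0ℚ , λ ()
boundedAbove {ℕ.suc n} f with boundedAbove (f ∘ suc)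
... | U , f≤U = f zero ⊔ U , λ
  { zero → ℚₚ.p≤p⊔q (f zero) U
  ; (suc x) → ℚₚ.≤-trans (f≤U x) (ℚₚ.p≤q⊔p (f zero) U)
  }

fromℕ : ℕ → ℚ
fromℕ ℕ.zero = 0ℚ
fromℕ (ℕ.suc k) = 1ℚ + fromℕ k

fromℕ-<-suc : ∀ k → fromℕ k < fromℕ (ℕ.suc k)
fromℕ-<-suc k = subst (_< fromℕ (ℕ.suc k)) (ℚₚ.+-identityˡ (fromℕ k)) (ℚₚ.+-monoˡ-< (fromℕ k) 0<1)

fromℕ-mono-< : ∀ {j k} → j ℕ.< k → fromℕ j < fromℕ k
fromℕ-mono-< {j} {ℕ.suc k} (s≤s j≤k) with ℕₚ.m≤n⇒m<n∨m≡n j≤k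
... | inj₁ j<k = ℚₚ.<-trans (fromℕ-mono-< j<k) (fromℕ-<-suc k)
... | inj₂ refl = fromℕ-<-suc k

fromℕ-mono-≤ : ∀ {j k} → j ℕ.≤ k → fromℕ j ≤ fromℕ k
fromℕ-mono-≤ j≤k with ℕₚ.m≤n⇒m<n∨m≡n j≤k
... | inj₁ j<k = ℚₚ.<⇒≤ (fromℕ-mono-< j<k)
... | inj₂ refl = ℚₚ.≤-refl

-- A vertex x is represented by the ray (−∞, ray x], a vertex y by the point "point y".
record PointsAndRays {n} (w : Fin n → ℚ) (S : ℚ) : Set where
  field
    point ray : Fin n → ℚ
    point≤ray⇔ : ∀ x y → point y ≤ ray x ⇔ (¬ S ≤ w x + w y)
    point-injective : Injective _≡_ _≡_ point

module PointsAndRaysConstruction {n} (w : Fin n → ℚ) (S δ : ℚ) (0<δ : 0ℚ < δ)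
  (separated : ∀ x y → Separated (w x + w y) S δ × Separated (w x) (w y) δ) where

  m N : ℚ
  m = fromℕ (ℕ.suc n)
  N = m + m

  rank : Fin n → ℚ
  rank x = fromℕ (toℕ x)

  -- Scaling the weights by N = 2m lets the gap δ dominate the tie-breaker δ · rank ∈ [0, m δ].
  point ray : Fin n → ℚ
  point y = N * w y + δ * rank y
  ray x = N * (S - w x) - m * δ

  0≤δ : 0ℚ ≤ δ
  0≤δ = ℚₚ.<⇒≤ 0<δ

  0<m : 0ℚ < m
  0<m = fromℕ-mono-< {k = ℕ.suc n} (s≤s ℕ.z≤n)

  0≤N : 0ℚ ≤ N
  0≤N = ℚₚ.<⇒≤ (ℚₚ.+-mono-< 0<m 0<m)

  0≤rank : ∀ x → 0ℚ ≤ rank x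
  0≤rank x = fromℕ-mono-≤ {k = toℕ x} ℕ.z≤n

  rank≤m : ∀ x → rank x ≤ m
  rank≤m x = fromℕ-mono-≤ {k = ℕ.suc n} (ℕₚ.m≤n⇒m≤1+n (toℕ≤n x))

  ray<point : ∀ {x y} → S ≤ w x + w y → ray x < point y
  ray<point {x} {y} S≤ = 0<q-p⇒p<q (subst (0ℚ <_) (sym (gap m S (w x) (w y) δ (rank y)))
    (ℚₚ.+-mono-≤-< (ℚₚ.+-mono-≤ (*-nonNeg 0≤N (p≤q⇒0≤q-p S≤)) (*-nonNeg 0≤δ (0≤rank y))) (*-pos 0<m 0<δ)))
    where
    gap : ∀ m s a b d r → ((m + m) * b + d * r) - ((m + m) * (s - a) - m * d)
                         ≡ (m + m) * ((a + b) - s) + d * r + m * d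
    gap = solve 6 (λ m s a b d r → ((m :+ m) :* b :+ d :* r) :- ((m :+ m) :* (s :- a) :- m :* d)
                                  := (m :+ m) :* ((a :+ b) :- s) :+ d :* r :+ m :* d) refl

  point≤ray : ∀ {x y} → δ ≤ S - (w x + w y) → point y ≤ ray x
  point≤ray {x} {y} δ≤ = 0≤q-p⇒p≤q (subst (0ℚ ≤_) (sym (gap m S (w x) (w y) δ (rank y)))
    (ℚₚ.+-mono-≤ (*-nonNeg 0≤N (p≤q⇒0≤q-p δ≤)) (*-nonNeg 0≤δ (p≤q⇒0≤q-p (rank≤m y)))))
    where
    gap : ∀ m s a b d r → ((m + m) * (s - a) - m * d) - ((m + m) * b + d * r)
                         ≡ (m + m) * ((s - (a + b)) - d) + d * (m - r)
    gap = solve 6 (λ m s a b d r → ((m :+ m) :* (s :- a) :- m :* d) :- ((m :+ m) :* b :+ d :* r)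
                                  := (m :+ m) :* ((s :- (a :+ b)) :- d) :+ d :* (m :- r)) refl

  point<point : ∀ {x y} → δ ≤ w y - w x → point x < point y
  point<point {x} {y} δ≤ = 0<q-p⇒p<q (subst (0ℚ <_) (sym (gap m (w x) (w y) δ (rank x) (rank y)))
    (ℚₚ.+-mono-≤-< (ℚₚ.+-mono-≤ (ℚₚ.+-mono-≤ (*-nonNeg 0≤N (p≤q⇒0≤q-p δ≤))
                                               (*-nonNeg 0≤δ (p≤q⇒0≤q-p (rank≤m x))))
                                  (*-nonNeg 0≤δ (0≤rank y)))
                    (*-pos 0<m 0<δ)))
    where
    gap : ∀ m a b d r r′ → ((m + m) * b + d * r′) - ((m + m) * a + d * r)
                          ≡ (m + m) * ((b - a) - d) + d * (m - r) + d * r′ + m * d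
    gap = solve 6 (λ m a b d r r′ → ((m :+ m) :* b :+ d :* r′) :- ((m :+ m) :* a :+ d :* r)
                                   := (m :+ m) :* ((b :- a) :- d) :+ d :* (m :- r) :+ d :* r′ :+ m :* d) refl

  point-mono : ∀ {x y} → w x ≤ w y → toℕ x ℕ.< toℕ y → point x < point y
  point-mono wx≤wy x<y = ℚₚ.+-mono-≤-<
    (ℚₚ.*-monoˡ-≤-nonNeg N {{ℚ.nonNegative 0≤N}} wx≤wy)
    (ℚₚ.*-monoʳ-<-pos δ {{ℚ.positive 0<δ}} (fromℕ-mono-< x<y))

  point≤ray⇔ : ∀ x y → point y ≤ ray x ⇔ (¬ S ≤ w x + w y)
  point≤ray⇔ x y = mk⇔
    (λ p≤r S≤ → ℚₚ.<-irrefl refl (ℚₚ.<-≤-trans (ray<point S≤) p≤r))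
    (λ S≰ → [ ⊥-elim ∘ S≰ , point≤ray ]′ (proj₁ (separated x y)))

  weight-≤ : ∀ {x y} → point x ≡ point y → w x ≤ w y
  weight-≤ {x} {y} eq = [ id , (λ δ≤ → ⊥-elim (ℚₚ.<⇒≢ (point<point δ≤) (sym eq))) ]′ (proj₂ (separated y x))

  point-injective : Injective _≡_ _≡_ point
  point-injective {x} {y} eq with ℕₚ.<-cmp (toℕ x) (toℕ y)
  ... | tri< x<y _ _ = ⊥-elim (ℚₚ.<⇒≢ (point-mono (weight-≤ eq) x<y) eq)
  ... | tri≈ _ x≡y _ = toℕ-injective x≡y
  ... | tri> _ _ y<x = ⊥-elim (ℚₚ.<⇒≢ (point-mono (weight-≤ (sym eq)) y<x) (sym eq))

abstract
  pointsAndRays : ∀ {n} (w : Fin n → ℚ) (S : ℚ) → PointsAndRays w S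
  pointsAndRays w S
    with eventually-∀ (λ x → eventually-∀ (λ y →
           eventually-× (eventually-separated (w x + w y) S) (eventually-separated (w x) (w y))))
  ... | δ , 0<δ , small = record { Construction }
    where module Construction = PointsAndRaysConstruction w S δ 0<δ (λ x y → small ℚₚ.≤-refl x y)

module DoubledBoxes {n} {H : Graph (Fin n)} (H-sym : ∀ u v → H u v → H v u)
  {c : Fin n → Bool} (split : IsSplitPartition (compl H) c)
  {k} (w : Fin k → Fin n → ℚ) (S : Fin k → ℚ)
  (cover : ∀ u v → u ≢ v → (H u v ⇔ (∃[ i ] (S i ≤ w i u + w i v)))) where

  module Coordinate (i : Fin k) where
    open PointsAndRays (pointsAndRays (w i) (S i)) public

    abstract
      B U K L : ℚ
      B = proj₁ (boundedBelow (λ x → point x ⊓ ray x))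
      U = B ⊔ proj₁ (boundedAbove point)
      K = B + B - 1ℚ
      L = K - U

      B≤point : ∀ x → B ≤ point x
      B≤point x = ℚₚ.≤-trans (proj₂ (boundedBelow _) x) (ℚₚ.p⊓q≤p (point x) (ray x))

      B≤ray : ∀ x → B ≤ ray x
      B≤ray x = ℚₚ.≤-trans (proj₂ (boundedBelow _) x) (ℚₚ.p⊓q≤q (point x) (ray x))

      point≤U : ∀ x → point x ≤ U
      point≤U x = ℚₚ.≤-trans (proj₂ (boundedAbove point) x) (ℚₚ.p≤q⊔p B _)

      L≤B : L ≤ B
      L≤B = 0≤q-p⇒p≤q (subst (0ℚ ≤_) (sym (gap B U))
        (ℚₚ.+-mono-≤ (p≤q⇒0≤q-p (ℚₚ.p≤p⊔q B _)) (ℚₚ.<⇒≤ 0<1)))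
        where
        gap : ∀ B U → B - ((B + B - 1ℚ) - U) ≡ (U - B) + 1ℚ
        gap = solve 2 (λ B U → B :- ((B :+ B :- con 1ℚ) :- U) := (U :- B) :+ con 1ℚ) refl

      L≤U : L ≤ U
      L≤U = ℚₚ.≤-trans L≤B (ℚₚ.p≤p⊔q B _)

      L≤ray : ∀ x → L ≤ ray x
      L≤ray x = ℚₚ.≤-trans L≤B (B≤ray x)

      L≤point : ∀ x → L ≤ point x
      L≤point x = ℚₚ.≤-trans L≤B (B≤point x)

      L+≤K : ∀ {a} → a ≤ U → L + a ≤ K
      L+≤K {a} a≤U = subst (L + a ≤_) (q-p+p≡q U K) (ℚₚ.+-monoʳ-≤ L a≤U)

      K<+ : ∀ {a b} → B ≤ a → B ≤ b → K < a + b
      K<+ {a} {b} B≤a B≤b = 0<q-p⇒p<q (subst (0ℚ <_) (sym (gap B a b))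
        (ℚₚ.+-mono-≤-< (ℚₚ.+-mono-≤ (p≤q⇒0≤q-p B≤a) (p≤q⇒0≤q-p B≤b)) 0<1))
        where
        gap : ∀ B a b → (a + b) - (B + B - 1ℚ) ≡ (a - B) + (b - B) + 1ℚ
        gap = solve 3 (λ B a b → (a :+ b) :- (B :+ B :- con 1ℚ) := (a :- B) :+ (b :- B) :+ con 1ℚ) refl

  open Coordinate

  lo hi : Fin k → Fin n → ℚ
  lo i x = if c x then L i else point i x
  hi i x = if c x then ray i x else point i x

  nonEdge⇔onRays : ∀ {x y} → x ≢ y → (¬ H x y) ⇔ (∀ i → point i y ≤ ray i x)
  nonEdge⇔onRays {x} {y} x≢y = mk⇔
    (λ ¬xy i → from (point≤ray⇔ i x y) (λ S≤ → ¬xy (from (cover x y x≢y) (i , S≤))))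
    (λ onRays xy → let (i , S≤) = to (cover x y x≢y) xy in to (point≤ray⇔ i x y) (onRays i) S≤)

  sameCopy : ∀ {x y} → x ≢ y → compl H x y ⇔ (∀ i → Overlap (lo i x) (hi i x) (lo i y) (hi i y))
  sameCopy {x} {y} x≢y with c x in cx | c y in cy
  ... | true | true = mk⇔ (λ _ i → L≤ray i y , L≤ray i x) (λ _ → proj₁ split x y cx cy x≢y)
  ... | true | false = mk⇔
    (λ (_ , ¬xy) i → L≤point i y , to (nonEdge⇔onRays x≢y) ¬xy i)
    (λ overlaps → x≢y , from (nonEdge⇔onRays x≢y) (proj₂ ∘ overlaps))
  ... | false | true = mk⇔
    (λ (_ , ¬xy) i → to (nonEdge⇔onRays (x≢y ∘ sym)) (¬xy ∘ H-sym y x) i , L≤point i x)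
    (λ overlaps → x≢y , from (nonEdge⇔onRays (x≢y ∘ sym)) (proj₁ ∘ overlaps) ∘ H-sym x y)
  ... | false | false = mk⇔
    (λ xy → ⊥-elim (proj₂ split x y cx cy xy))
    (λ overlaps → x≢y , λ xy → let (i , _) = to (cover x y x≢y) xy in
      x≢y (point-injective i (ℚₚ.≤-antisym (proj₁ (overlaps i)) (proj₂ (overlaps i)))))

  -- Needs a coordinate: with none, an independent vertex would be adjacent to its own copy.
  crossCopy : Fin k → ∀ x y →
    doubled (compl H) c (inj₁ x) (inj₂ y) ⇔ (∀ i → Overlap (K i - hi i x) (K i - lo i x) (lo i y) (hi i y))
  crossCopy i₀ x y with c x | c y
  ... | true | true = mk⇔
    (λ _ i → from (reflected-overlap⇔ (K i))
      (ℚₚ.<⇒≤ (K<+ i (B≤ray i x) (B≤ray i y)) , L+≤K i (L≤U i)))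
    (λ _ → inj₁ (refl , refl))
  ... | true | false = mk⇔
    (λ _ i → from (reflected-overlap⇔ (K i)) (ℚₚ.<⇒≤ (K<+ i (B≤ray i x) (B≤point i y)) , L+≤K i (point≤U i y)))
    (λ _ → inj₂ (inj₁ (refl , refl)))
  ... | false | true = mk⇔
    (λ _ i → from (reflected-overlap⇔ (K i))
      (ℚₚ.<⇒≤ (K<+ i (B≤point i x) (B≤ray i y)) ,
       subst (_≤ K i) (ℚₚ.+-comm (L i) (point i x)) (L+≤K i (point≤U i x))))
    (λ _ → inj₂ (inj₂ (refl , refl)))
  ... | false | false = mk⇔
    (λ { (inj₁ (() , _)) ; (inj₂ (inj₁ (() , _))) ; (inj₂ (inj₂ (() , _))) })
    (λ overlaps → ⊥-elim (ℚₚ.<-irrefl refl (ℚₚ.<-≤-trans (K<+ i₀ (B≤point i₀ x) (B≤point i₀ y))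
                                                         (proj₂ (to (reflected-overlap⇔ (K i₀)) (overlaps i₀))))))

  l r : Fin k → Fin n ⊎ Fin n → ℚ
  l i (inj₁ x) = K i - hi i x
  l i (inj₂ x) = lo i x
  r i (inj₁ x) = K i - lo i x
  r i (inj₂ x) = hi i x

  lo≤hi : ∀ i x → lo i x ≤ hi i x
  lo≤hi i x with c x
  ... | true = L≤ray i x
  ... | false = ℚₚ.≤-refl

  l≤r : ∀ i u → l i u ≤ r i u
  l≤r i (inj₁ x) = from (reflect-≤ (K i)) (lo≤hi i x)
  l≤r i (inj₂ x) = lo≤hi i x

  boxRep : Fin k → BoxRep (doubled (compl H) c) k
  boxRep i₀ = l , r , l≤r , adjacency
    where
    adjacency : ∀ u v → u ≢ v → doubled (compl H) c u v ⇔ (∀ i → Overlap (l i u) (r i u) (l i v) (r i v))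
    adjacency (inj₁ x) (inj₁ y) u≢v = Π-⇔ (λ i → ⇔-sym (overlap-reflect (K i))) ⇔-∘ sameCopy (u≢v ∘ cong inj₁)
    adjacency (inj₂ x) (inj₂ y) u≢v = sameCopy (u≢v ∘ cong inj₂)
    adjacency (inj₁ x) (inj₂ y) _ = crossCopy i₀ x y
    adjacency (inj₂ x) (inj₁ y) _ = Π-⇔ (λ _ → overlap-swap) ⇔-∘ crossCopy i₀ y x

edgeless⇒completeSplit : ∀ {V} {E : Graph V} → (∀ u v → ¬ E u v) → IsCompleteSplit E
edgeless⇒completeSplit noEdge = (λ _ → false) , ((λ _ _ ()) , (λ u v _ _ → noEdge u v)) , (λ _ _ ())

lemma9 : (n : ℕ) (H : Graph (Fin n)) → IsSimple H → IsSplit H → ¬ IsCompleteSplit H →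
    (c : Fin n → Bool) → IsSplitPartition (compl H) c →
    (k : ℕ) → ThresholdCover H k → BoxicityAtMost (doubled (compl H) c) k
lemma9 _ H (_ , irreflexive) _ notCompleteSplit _ _ ℕ.zero (_ , _ , cover) =
  ⊥-elim (notCompleteSplit (edgeless⇒completeSplit noEdge))
  where
  noEdge : ∀ u v → ¬ H u v
  noEdge u v uv with u ≟ v
  ... | yes refl = irreflexive u uv
  ... | no u≢v with to (cover u v u≢v) uv
  ...   | () , _
lemma9 _ _ (H-sym , _) _ _ _ split (ℕ.suc k) (w , S , cover) =
  ℕ.suc k , ℕₚ.≤-refl , DoubledBoxes.boxRep H-sym split w S cover zero
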